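{- $f_{\mathsf{AP}}$ maps $\mathsf{CAsc}_n$ into $\mathsf{CPosets}_n$, and $f_{\mathsf{AP}}: \mathsf{CAsc}_n \to \mathsf{CPosets}_n$ is a bijection.
   Context: $\mathsf{CAsc}_n$ is the set of $101$-avoiding ascent sequences of length $n$ (ascent sequence: $a_1=0$, $a_i\le\mathsf{asc}(a_1,\ldots,a_{i-1})+1$; $101$-avoiding: no $i<j<k$ with $a_i=a_k>a_j$). $\mathsf{CPosets}_n$ is the set of unlabelled series-parallel (2+2)-free posets on $n$ elements, i.e. posets that are both (2+2)-free and N-free. $f_{\mathsf{AP}}$ maps ascent sequences to (2+2)-free posets: with strict downsets $\emptyset=D_0\subsetneq\cdots\subsetneq D_{\ell(P)}$, level $L_i$ = elements with strict downset $D_i$, $\ell^\star(P)$ = minimum index of a level containing a maximal element; start from a one-element poset; given $P^{(k)}$: (AP1) if $a_{k+1}\le\ell^\star(P^{(k)})$, add a new maximal element covering the same elements as the elements of $L_{a_{k+1}}$; (AP2) if $a_{k+1}=1+\ell(P^{(k)})$, add a new element covering all maximal elements; (AP3) if $\ell^\star<a_{k+1}\le\ell$, add a new element covering the same elements as those of $L_{a_{k+1}}$ and add relations $x\prec y$ for every maximal $x$ at level $<a_{k+1}$ and every old $y$ at level $\ge a_{k+1}$. $f_{\mathsf{AP}}$ is a bijection from ascent sequences of length $n$ to (2+2)-free posets on $n$ elements. -}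

module Defs where

open import Data.Bool using (Bool; true; false; _∧_; _∨_; not; if_then_else_; T)
open import Data.Nat using (ℕ; zero; suc; _+_; _≤_; _<ᵇ_; _≡ᵇ_; _≤ᵇ_; _⊔_; _⊓_)
open import Data.Fin using (Fin; zero; suc; toℕ) renaming (_<_ to _<ᶠ_)
open import Data.List using (List; []; _∷_; length; map; foldr; allFin; filterᵇ; take)
open import Data.Bool.ListAction using (all; any)
open import Data.Vec using (Vec; lookup; toList; init; last)
open import Data.Product using (Σ; _×_; ∃-syntax)
open import Relation.Binary.PropositionalEquality using (_≡_; _≢_)
open import Relation.Nullary using (¬_)
open import Function.Bundles using (_↔_; Inverse)

asc : List ℕ → ℕ
asc (x ∷ y ∷ xs) = (if x <ᵇ y then 1 else 0) + asc (y ∷ xs)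
asc _ = 0

-- a_1 = 0 and a_i ≤ asc(a_1 … a_{i-1}) + 1  (indices are 0-based here)
IsAscent : ∀ {n} → Vec ℕ n → Set
IsAscent {n} v =
  (∀ (i : Fin n) → toℕ i ≡ 0 → lookup v i ≡ 0) ×
  (∀ (i : Fin n) → lookup v i ≤ suc (asc (take (toℕ i) (toList v))))

Avoids101 : ∀ {n} → Vec ℕ n → Set
Avoids101 {n} v = ∀ (i j k : Fin n) → i <ᶠ j → j <ᶠ k →
  lookup v i ≡ lookup v k → ¬ (lookup v j Data.Nat.< lookup v i)

CAsc : ∀ {n} → Vec ℕ n → Set
CAsc v = IsAscent v × Avoids101 v

-- Finite posets on Fin n, given by a decidable (Bool-valued) strict order
-- lt x y = true  means  x ≺ y.

BRel : ℕ → Set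
BRel n = Fin n → Fin n → Bool

IsStrictPoset : ∀ {n} → BRel n → Set
IsStrictPoset {n} lt =
  (∀ (x : Fin n) → lt x x ≡ false) ×
  (∀ (x y z : Fin n) → T (lt x y) → T (lt y z) → T (lt x z))

Incomp : ∀ {n} → BRel n → Fin n → Fin n → Set
Incomp lt x y = ¬ T (lt x y) × ¬ T (lt y x)

TwoPlusTwoFree : ∀ {n} → BRel n → Set
TwoPlusTwoFree {n} lt = ¬ (Σ (Fin n) λ a → Σ (Fin n) λ b → Σ (Fin n) λ c → Σ (Fin n) λ d →
  a ≢ b × a ≢ c × a ≢ d × b ≢ c × b ≢ d × c ≢ d ×
  T (lt a b) × T (lt c d) ×
  Incomp lt a c × Incomp lt a d × Incomp lt b c × Incomp lt b d)

NFree : ∀ {n} → BRel n → Set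
NFree {n} lt = ¬ (Σ (Fin n) λ a → Σ (Fin n) λ b → Σ (Fin n) λ c → Σ (Fin n) λ d →
  a ≢ b × a ≢ c × a ≢ d × b ≢ c × b ≢ d × c ≢ d ×
  T (lt a b) × T (lt c b) × T (lt c d) ×
  Incomp lt a c × Incomp lt a d × Incomp lt b d)

-- membership in CPosets_n (series-parallel = N-free, and (2+2)-free)
CPoset : ∀ {n} → BRel n → Set
CPoset lt = IsStrictPoset lt × TwoPlusTwoFree lt × NFree lt

-- isomorphism of posets on Fin n (unlabelled posets = isomorphism classes)
Iso : ∀ {n} → BRel n → BRel n → Set
Iso {n} lt lt' = Σ (Fin n ↔ Fin n) λ σ →
  ∀ (x y : Fin n) → lt x y ≡ lt' (Inverse.to σ x) (Inverse.to σ y)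

module Levels {k : ℕ} (lt : BRel k) where

  elems : List (Fin k)
  elems = allFin k

  down : Fin k → Fin k → Bool
  down x y = lt y x

  sub : Fin k → Fin k → Bool
  sub x y = all (λ z → not (down x z) ∨ down y z) elems

  sameD : Fin k → Fin k → Bool
  sameD x y = sub x y ∧ sub y x

  rep : Fin k → Bool
  rep y = all (λ z → not ((toℕ z <ᵇ toℕ y) ∧ sameD z y)) elems

  -- level of x: number of distinct strict downsets properly contained in D(x)
  level : Fin k → ℕ
  level x = length (filterᵇ (λ y → rep y ∧ sub y x ∧ not (sub x y)) elems)

  isMax : Fin k → Bool
  isMax x = all (λ y → not (lt x y)) elems

  ell : ℕ
  ell = foldr _⊔_ 0 (map level elems)

  ellStar : ℕ
  ellStar = foldr _⊓_ ell (map level (filterᵇ isMax elems))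

  -- x ∈ D_a (the common strict downset of the elements of level a)
  inD : ℕ → Fin k → Bool
  inD a x = any (λ z → (level z ≡ᵇ a) ∧ lt x z) elems

-- One step of f_AP.  The new element is `zero`; old element x becomes `suc x`.

step : ∀ {k} → BRel k → ℕ → BRel (suc k)
step {k} lt a = rel
  where
  open Levels lt
  case1 case2 : Bool
  case1 = a ≤ᵇ ellStar
  case2 = a ≡ᵇ suc ell

  newAbove : Fin k → Bool
  newAbove x = if case1 then inD a x else (if case2 then true else inD a x)

  extra : Fin k → Fin k → Bool
  extra x y = if case1 then false else (if case2 then false else
    (isMax x ∧ (level x <ᵇ a) ∧ (a ≤ᵇ level y)))

  rel : BRel (suc k)
  rel zero    _       = false
  rel (suc x) zero    = newAbove x
  rel (suc x) (suc y) = lt x y ∨ extra x y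

fAP : ∀ {n} → Vec ℕ n → BRel n
fAP {zero}        v = λ ()
fAP {suc zero}    v = λ _ _ → false
fAP {suc (suc n)} v = step (fAP (init v)) (last v)

-- Read the i-th letter a_i of v as the interval [a_i, max(a_1, …, a_i)].  For a 101-avoiding ascent
-- sequence every ascent is a new maximum, and every other letter is at most its predecessor and lies
-- strictly inside no earlier interval; these are the steps (AP2) and (AP1) of f_AP, and (AP3) never
-- occurs.  Inductively, f_AP(v) is the interval order of these intervals: the level of an element is
-- its left endpoint and ℓ⋆ is the last letter.  Interval orders are (2+2)-free, and an N would give a
-- pattern 101.  Every value up to the maximum occurs as a degenerate interval [t, t], which pins down
-- both endpoints of every interval up to isomorphism; so an isomorphism determines the last letter and,
-- after a transposition, restricts to the prefixes.  Conversely, delete from a (2+2)- and N-free poset a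
-- maximal element whose downset is smallest among the maximal ones and represent the rest by
-- induction; the two forbidden patterns force the deleted downset to be {x : right end of x < a} for a
-- letter a that extends the sequence admissibly.

module Submission where

open import Defs
open import Data.Bool using (Bool; true; false; _∧_; _∨_; not; if_then_else_; T)
open import Data.Bool.Properties using (∧-distribˡ-∨; ∨-identityʳ; T-∧; T-≡; T?)
open import Data.Bool.ListAction using (all; any)
open import Data.Empty using (⊥; ⊥-elim)
open import Data.Unit using (⊤; tt)
open import Data.Fin using (Fin; zero; suc; toℕ; fromℕ<; fromℕ; inject₁; opposite)
open import Data.Fin.Relation.Unary.Top using (view; ‵fromℕ; ‵inject₁)
open import Data.Fin.Properties
  using ( toℕ-injective; toℕ-inject; toℕ-fromℕ<; toℕ-fromℕ; toℕ-inject₁; toℕ<n; opposite-prop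
        ; opposite-involutive; ¬∀⟶∃¬-smallest; ¬∀⟶∃¬; all?)
  renaming (suc-injective to fsuc-injective; _≟_ to _≟ᶠ_)
open import Data.List using (List; []; _∷_; length; map; foldr; filterᵇ; tabulate; allFin; take)
open import Data.List.Properties using (take-all)
open import Data.List.Membership.Propositional using (_∈_; lose)
open import Data.List.Membership.Propositional.Properties using (∈-allFin; ∈-filter⁺; ∈-filter⁻)
open import Data.List.Relation.Unary.All as All using (All; []; _∷_)
open import Data.List.Relation.Unary.Any as Any using (Any; here; there)
open import Data.List.Relation.Unary.All.Properties as All using (all⁺; all⁻; tabulate⁺)
open import Data.List.Relation.Unary.Any.Properties as Any using (any⁺; any⁻)
open import Data.Nat
open import Data.Nat.Properties
open import Data.Vec using (Vec; []; _∷_; _∷ʳ_; init; last; initLast; lookup; toList)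
open import Data.Vec.Properties using (length-toList; init-∷ʳ; last-∷ʳ)
open import Data.Product using (Σ; ∃; _×_; _,_; proj₁; proj₂)
open import Data.Sum using (_⊎_; inj₁; inj₂; [_,_])
open import Function.Base using (_∘_; _∘₂_; id; case_of_)
open import Function.Bundles using (_⇔_; mk⇔; Equivalence)
open import Data.Fin.Permutation as Perm
  using (Permutation′; _⟨$⟩ʳ_; _⟨$⟩ˡ_; _∘ₚ_; inverseˡ; inverseʳ; remove; lift₀; lift₀-remove)
import Data.Fin.Permutation.Components as PC
open import Relation.Binary.Definitions using (tri<; tri≈; tri>)
open import Relation.Binary.PropositionalEquality
  using (_≡_; _≢_; refl; sym; trans; cong; cong₂; subst; subst₂; module ≡-Reasoning)
open import Relation.Nullary using (¬_; Dec; yes; no; ¬?; _→-dec_; decidable-stable)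

open Equivalence using (to; from)

T-ext : ∀ {a b} → (T a → T b) → (T b → T a) → a ≡ b
T-ext {false} {false} _ _ = refl
T-ext {false} {true}  _ g = ⊥-elim (g _)
T-ext {true}  {false} f _ = ⊥-elim (f _)
T-ext {true}  {true}  _ _ = refl

¬T⇒≡false : ∀ {a} → ¬ T a → a ≡ false
¬T⇒≡false {false} _ = refl
¬T⇒≡false {true}  h = ⊥-elim (h _)

T-not : ∀ {a} → T (not a) ⇔ (¬ T a)
T-not {false} = mk⇔ (λ _ ()) (λ _ → _)
T-not {true}  = mk⇔ (λ ()) (λ h → h _)

T-not∨ : ∀ {a b} → T (not a ∨ b) ⇔ (T a → T b)
T-not∨ {false} = mk⇔ (λ _ ()) (λ _ → _)
T-not∨ {true}  = mk⇔ (λ t _ → t) (λ f → f _)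

¬-implication : ∀ {a b} → ¬ (T a → T b) → T a × ¬ T b
¬-implication {true}  {false} _ = _ , λ ()
¬-implication {true}  {true}  h = ⊥-elim (h _)
¬-implication {false}         h = ⊥-elim (h λ ())

<ᵇ-suc : ∀ x c → (x <ᵇ suc c) ≡ ((x <ᵇ c) ∨ (x ≡ᵇ c))
<ᵇ-suc zero    zero    = refl
<ᵇ-suc zero    (suc c) = refl
<ᵇ-suc (suc x) zero    = refl
<ᵇ-suc (suc x) (suc c) = <ᵇ-suc x c

module _ {k : ℕ} {p : Fin k → Bool} where

  T-all-allFin : T (all p (allFin k)) ⇔ (∀ i → T (p i))
  T-all-allFin = mk⇔ (λ t i → All.lookup (all⁺ p (allFin k) t) (∈-allFin i))
                     (λ h → all⁻ p {allFin k} (All.tabulate λ {i} _ → h i))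

  T-any-allFin : T (any p (allFin k)) ⇔ ∃ (T ∘ p)
  T-any-allFin = mk⇔ (λ t → Any.satisfied (any⁻ p (allFin k) t))
                     (λ (i , t) → any⁺ p (lose (∈-allFin i) t))

foldr-⊔-≡ : ∀ {m} (xs : List ℕ) → All (_≤ m) xs → Any (m ≤_) xs → foldr _⊔_ 0 xs ≡ m
foldr-⊔-≡ {m} xs ≤m m≤ = ≤-antisym (upper xs ≤m) (lower xs m≤)
  where
  upper : ∀ xs → All (_≤ m) xs → foldr _⊔_ 0 xs ≤ m
  upper []       []         = z≤n
  upper (x ∷ xs) (x≤ ∷ xs≤) = ⊔-lub x≤ (upper xs xs≤)
  lower : ∀ xs → Any (m ≤_) xs → m ≤ foldr _⊔_ 0 xs
  lower (x ∷ xs) (here m≤x)   = ≤-trans m≤x (m≤m⊔n x _)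
  lower (x ∷ xs) (there m≤xs) = ≤-trans (lower xs m≤xs) (m≤n⊔m x _)

foldr-⊓-≡ : ∀ {b m} (xs : List ℕ) → m ≤ b → All (m ≤_) xs → Any (_≤ m) xs → foldr _⊓_ b xs ≡ m
foldr-⊓-≡ {b} {m} xs m≤b m≤ ≤m = ≤-antisym (upper xs ≤m) (lower xs m≤)
  where
  upper : ∀ xs → Any (_≤ m) xs → foldr _⊓_ b xs ≤ m
  upper (x ∷ xs) (here x≤m)   = ≤-trans (m⊓n≤m x _) x≤m
  upper (x ∷ xs) (there xs≤m) = ≤-trans (m⊓n≤n x _) (upper xs xs≤m)
  lower : ∀ xs → All (m ≤_) xs → m ≤ foldr _⊓_ b xs
  lower []       []         = m≤b
  lower (x ∷ xs) (m≤x ∷ m≤xs) = ⊓-glb m≤x (lower xs m≤xs)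

count : ∀ {k} → (Fin k → Bool) → ℕ
count {zero}  p = 0
count {suc k} p = (if p zero then 1 else 0) + count (p ∘ suc)

length-filterᵇ-tabulate : ∀ {A : Set} {k} (p : A → Bool) (f : Fin k → A) →
                          length (filterᵇ p (tabulate f)) ≡ count (p ∘ f)
length-filterᵇ-tabulate {k = zero}  p f = refl
length-filterᵇ-tabulate {k = suc k} p f with p (f zero)
... | true  = cong suc (length-filterᵇ-tabulate p (f ∘ suc))
... | false = length-filterᵇ-tabulate p (f ∘ suc)

count-cong : ∀ {k} {p q : Fin k → Bool} → (∀ i → p i ≡ q i) → count p ≡ count q
count-cong {zero}  eq = refl
count-cong {suc k} eq = cong₂ _+_ (cong (λ b → if b then 1 else 0) (eq zero)) (count-cong (eq ∘ suc))

count-none : ∀ {k} (p : Fin k → Bool) → (∀ i → ¬ T (p i)) → count p ≡ 0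
count-none {zero}  p none = refl
count-none {suc k} p none with p zero in eq
... | true  = ⊥-elim (none zero (subst T (sym eq) _))
... | false = count-none (p ∘ suc) (none ∘ suc)

count-unique : ∀ {k} (p : Fin k → Bool) (i₀ : Fin k) → T (p i₀) → (∀ i → T (p i) → i ≡ i₀) →
               count p ≡ 1
count-unique {suc k} p zero t only with p zero
... | true  = cong suc (count-none (p ∘ suc) λ i t → case only (suc i) t of λ ())
count-unique {suc k} p (suc i₀) t only with p zero in eq
... | true  = case only zero (subst T (sym eq) _) of λ ()
... | false = count-unique (p ∘ suc) i₀ t λ i t → fsuc-injective (only (suc i) t)

count-∨ : ∀ {k} (p q : Fin k → Bool) → (∀ i → T (p i) → ¬ T (q i)) →
          count (λ i → p i ∨ q i) ≡ count p + count q
count-∨ {zero}  p q disj = refl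
count-∨ {suc k} p q disj with p zero in ep | q zero in eq | count-∨ (p ∘ suc) (q ∘ suc) (disj ∘ suc)
... | true  | true  | _  = ⊥-elim (disj zero (subst T (sym ep) _) (subst T (sym eq) _))
... | true  | false | ih = cong suc ih
... | false | true  | ih = trans (cong suc ih) (sym (+-suc _ _))
... | false | false | ih = ih

module _ {k} (f : Fin k → ℕ) (first : Fin k → Bool)
         (first⇔ : ∀ y → T (first y) ⇔ (∀ z → toℕ z < toℕ y → f z ≢ f y)) where

  count-first-≡ : ∀ c → ∃ (λ z → f z ≡ c) → count (λ y → first y ∧ (f y ≡ᵇ c)) ≡ 1
  count-first-≡ c (z , fz≡c) =
    count-unique _ y₀ (from T-∧ (from (first⇔ y₀) first-y₀ , ≡⇒≡ᵇ _ _ fy₀≡c)) unique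
    where
    least = ¬∀⟶∃¬-smallest k (λ y → f y ≢ c) (λ y → ¬? (f y ≟ c)) (λ all≢ → all≢ z fz≡c)
    y₀ = proj₁ least
    fy₀≡c : f y₀ ≡ c
    fy₀≡c = decidable-stable (f y₀ ≟ c) (proj₁ (proj₂ least))
    before : ∀ z → toℕ z < toℕ y₀ → f z ≢ c
    before z lt = subst (λ z → f z ≢ c)
      (toℕ-injective (trans (toℕ-inject (fromℕ< lt)) (toℕ-fromℕ< lt)))
      (proj₂ (proj₂ least) (fromℕ< lt))
    first-y₀ : ∀ z → toℕ z < toℕ y₀ → f z ≢ f y₀
    first-y₀ z lt e = before z lt (trans e fy₀≡c)
    unique : ∀ y → T (first y ∧ (f y ≡ᵇ c)) → y ≡ y₀
    unique y t with to (T-∧ {first y}) t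
    ... | fst , eqᵇ with <-cmp (toℕ y) (toℕ y₀)
    ... | tri< lt _ _ = ⊥-elim (before y lt (≡ᵇ⇒≡ _ _ eqᵇ))
    ... | tri≈ _ e _  = toℕ-injective e
    ... | tri> _ _ gt = ⊥-elim (to (first⇔ y) fst y₀ gt (trans fy₀≡c (sym (≡ᵇ⇒≡ _ _ eqᵇ))))

  count-first-< : ∀ c → (∀ t → t < c → ∃ λ z → f z ≡ t) → count (λ y → first y ∧ (f y <ᵇ c)) ≡ c
  count-first-< zero    _        = count-none _ λ y t → n≮0 (<ᵇ⇒< (f y) 0 (proj₂ (to (T-∧ {first y}) t)))
  count-first-< (suc c) attained = begin
    count (λ y → first y ∧ (f y <ᵇ suc c))
      ≡⟨ count-cong (λ y → trans (cong (first y ∧_) (<ᵇ-suc (f y) c)) (∧-distribˡ-∨ (first y) _ _)) ⟩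
    count (λ y → (first y ∧ (f y <ᵇ c)) ∨ (first y ∧ (f y ≡ᵇ c)))
      ≡⟨ count-∨ _ _ disjoint ⟩
    count (λ y → first y ∧ (f y <ᵇ c)) + count (λ y → first y ∧ (f y ≡ᵇ c))
      ≡⟨ cong₂ _+_ (count-first-< c λ t lt → attained t (m<n⇒m<1+n lt)) (count-first-≡ c (attained c ≤-refl)) ⟩
    c + 1
      ≡⟨ +-comm c 1 ⟩
    suc c ∎
    where
    open ≡-Reasoning
    disjoint : ∀ y → T (first y ∧ (f y <ᵇ c)) → ¬ T (first y ∧ (f y ≡ᵇ c))
    disjoint y t t′ = <-irrefl (≡ᵇ⇒≡ (f y) c (proj₂ (to (T-∧ {first y}) t′)))
                               (<ᵇ⇒< (f y) c (proj₂ (to (T-∧ {first y}) t)))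

-- The interval order of a sequence

-- Element zero of Fin n is the last letter of v (the element added by the last step of f_AP) and
-- suc x is element x of init v.  Element x is the interval [lo v x , hi v x] formed by its letter
-- and the maximum of the prefix of v ending with that letter.
top : ∀ {n} → Vec ℕ n → ℕ
top {zero}  v = 0
top {suc n} v = top (init v) ⊔ last v

lo hi : ∀ {n} → Vec ℕ n → Fin n → ℕ
lo {suc n} v zero    = last v
lo {suc n} v (suc x) = lo (init v) x
hi {suc n} v zero    = top v
hi {suc n} v (suc x) = hi (init v) x

Interval : ∀ {n} → Vec ℕ n → BRel n
Interval v x y = hi v x <ᵇ lo v y

Interval⇒< : ∀ {n} (v : Vec ℕ n) x y → T (Interval v x y) → hi v x < lo v y
Interval⇒< v x y = <ᵇ⇒< (hi v x) (lo v y)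

<⇒Interval : ∀ {n} (v : Vec ℕ n) x y → hi v x < lo v y → T (Interval v x y)
<⇒Interval v x y = <⇒<ᵇ

¬Interval⇒≤ : ∀ {n} (v : Vec ℕ n) x y → ¬ T (Interval v x y) → lo v y ≤ hi v x
¬Interval⇒≤ v x y h = ≮⇒≥ (h ∘ <⇒<ᵇ)

lo≤hi : ∀ {n} (v : Vec ℕ n) x → lo v x ≤ hi v x
lo≤hi {suc n} v zero    = m≤n⊔m (top (init v)) (last v)
lo≤hi {suc n} v (suc x) = lo≤hi (init v) x

hi≤top : ∀ {n} (v : Vec ℕ n) x → hi v x ≤ top v
hi≤top {suc n} v zero    = ≤-refl
hi≤top {suc n} v (suc x) = ≤-trans (hi≤top (init v) x) (m≤m⊔n (top (init v)) (last v))

lo≤top : ∀ {n} (v : Vec ℕ n) x → lo v x ≤ top v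
lo≤top v x = ≤-trans (lo≤hi v x) (hi≤top v x)

hi-antitone : ∀ {n} (v : Vec ℕ n) x y → toℕ y ≤ toℕ x → hi v x ≤ hi v y
hi-antitone {suc n} v x       zero    _         = hi≤top v x
hi-antitone {suc n} v (suc x) (suc y) (s≤s y≤x) = hi-antitone (init v) x y y≤x

Maximal : ∀ {n} → BRel n → Fin n → Set
Maximal P x = ∀ y → ¬ T (P x y)

Interval-maximal : ∀ {n} (v : Vec ℕ n) x → hi v x ≡ top v → Maximal (Interval v) x
Interval-maximal v x hi≡top y x≺y = <⇒≱ (Interval⇒< v x y x≺y) (subst (lo v y ≤_) (sym hi≡top) (lo≤top v y))

Interval-irreflexive : ∀ {n} (v : Vec ℕ n) x → Interval v x x ≡ false
Interval-irreflexive v x = ¬T⇒≡false λ x≺x → <⇒≱ (Interval⇒< v x x x≺x) (lo≤hi v x)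

Interval-transitive : ∀ {n} (v : Vec ℕ n) x y z → T (Interval v x y) → T (Interval v y z) → T (Interval v x z)
Interval-transitive v x y z x≺y y≺z =
  <⇒Interval v x z (<-trans (Interval⇒< v x y x≺y) (≤-<-trans (lo≤hi v y) (Interval⇒< v y z y≺z)))

Interval-2+2-free : ∀ {n} (v : Vec ℕ n) → TwoPlusTwoFree (Interval v)
Interval-2+2-free v (a , b , c , d , _ , _ , _ , _ , _ , _ , a≺b , c≺d , _ , (a⊀d , _) , (_ , c⊀b) , _) =
  <-irrefl refl (begin-strict
    hi v a <⟨ Interval⇒< v a b a≺b ⟩
    lo v b ≤⟨ ¬Interval⇒≤ v c b c⊀b ⟩
    hi v c <⟨ Interval⇒< v c d c≺d ⟩
    lo v d ≤⟨ ¬Interval⇒≤ v a d a⊀d ⟩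
    hi v a ∎)
  where open ≤-Reasoning

Unstraddled : ∀ {n} → Vec ℕ n → ℕ → Set
Unstraddled v a = ∀ y → a ≤ hi v y → a ≤ lo v y

-- The alternatives are the steps (AP2) and (AP1) of f_AP.
AdmissibleStep : ∀ {n} → Vec ℕ (suc n) → ℕ → Set
AdmissibleStep xs a = a ≡ suc (top xs) ⊎ (a ≤ last xs × Unstraddled xs a)

Admissible : ∀ {n} → Vec ℕ n → Set
Admissible {zero}        v = ⊤
Admissible {suc zero}    v = last v ≡ 0
Admissible {suc (suc n)} v = Admissible (init v) × AdmissibleStep (init v) (last v)

top-new : ∀ {n} (v : Vec ℕ (suc n)) → last v ≡ suc (top (init v)) → top v ≡ suc (top (init v))
top-new v eq = trans (m≤n⇒m⊔n≡n (subst (top (init v) ≤_) (sym eq) (n≤1+n _))) eq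

top-old : ∀ {n} (v : Vec ℕ (suc (suc n))) → last v ≤ last (init v) → top v ≡ top (init v)
top-old v le = m≥n⇒m⊔n≡m (≤-trans le (lo≤top (init v) zero))

-- point is where the running maximum of v first reaches t; being a new maximum, its interval is [t, t].
record Reach {n} (v : Vec ℕ n) (t : ℕ) : Set where
  field
    point    : Fin n
    lo-point : lo v point ≡ t
    hi-point : hi v point ≡ t
    earliest : ∀ y → t ≤ hi v y → toℕ y ≤ toℕ point

reach-init : ∀ {n} {v : Vec ℕ (suc n)} {t} → Reach (init v) t → Reach v t
reach-init {v = v} {t} r = record { point = suc point ; lo-point = lo-point ; hi-point = hi-point ; earliest = earliest′ }
  where
  open Reach r
  earliest′ : ∀ y → t ≤ hi v y → toℕ y ≤ toℕ (suc point)
  earliest′ zero    _    = z≤n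
  earliest′ (suc y) t≤hi = s≤s (earliest y t≤hi)

reach : ∀ {n} (v : Vec ℕ (suc n)) → Admissible v → ∀ t → t ≤ top v → Reach v t
reach {zero} v v₀≡0 t t≤top = record
  { point = zero ; lo-point = sym t≡last ; hi-point = sym t≡last ; earliest = λ { zero _ → z≤n } }
  where
  t≡last : t ≡ last v
  t≡last = trans (n≤0⇒n≡0 (subst (t ≤_) v₀≡0 t≤top)) (sym v₀≡0)
reach {suc n} v (adm , inj₁ new) t t≤top with m≤n⇒m<n∨m≡n (subst (t ≤_) (top-new v new) t≤top)
... | inj₁ (s≤s t≤top′) = reach-init (reach (init v) adm t t≤top′)
... | inj₂ refl = record
  { point = zero ; lo-point = new ; hi-point = top-new v new ; earliest = earliest }
  where
  earliest : ∀ y → suc (top (init v)) ≤ hi v y → toℕ y ≤ 0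
  earliest zero    _  = z≤n
  earliest (suc y) le = ⊥-elim (<⇒≱ (s≤s (hi≤top (init v) y)) le)
reach {suc n} v (adm , inj₂ (a≤last , _)) t t≤top =
  reach-init (reach (init v) adm t (subst (t ≤_) (top-old v a≤last) t≤top))

last≤lo-of-top : ∀ {n} (v : Vec ℕ (suc n)) → Admissible v → ∀ x → hi v x ≡ top v → last v ≤ lo v x
last≤lo-of-top v adm zero _ = ≤-refl
last≤lo-of-top {suc n} v (adm , inj₁ new) (suc y) hi≡top =
  ⊥-elim (<⇒≱ (s≤s (hi≤top (init v) y)) (≤-reflexive (trans (sym (top-new v new)) (sym hi≡top))))
last≤lo-of-top {suc n} v (adm , inj₂ (a≤last , _)) (suc y) hi≡top =
  ≤-trans a≤last (last≤lo-of-top (init v) adm y (trans hi≡top (top-old v a≤last)))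

-- Avoids101 in the indexing of lo and hi, where element zero is the last letter.
Avoids101ʳ : ∀ {n} → Vec ℕ n → Set
Avoids101ʳ {n} v = ∀ (x y z : Fin n) → toℕ x < toℕ y → toℕ y < toℕ z → lo v x ≡ lo v z → lo v x ≤ lo v y

Admissible⇒Avoids101ʳ : ∀ {n} (v : Vec ℕ n) → Admissible v → Avoids101ʳ v
Admissible⇒Avoids101ʳ {suc (suc n)} v (adm , _) (suc x) (suc y) (suc z) (s≤s x<y) (s≤s y<z) eq =
  Admissible⇒Avoids101ʳ (init v) adm x y z x<y y<z eq
Admissible⇒Avoids101ʳ {suc (suc n)} v (_ , inj₁ new) zero (suc y) (suc z) _ _ eq =
  ⊥-elim (<⇒≱ (s≤s (lo≤top (init v) z)) (≤-reflexive (trans (sym new) eq)))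
Admissible⇒Avoids101ʳ {suc (suc n)} v (_ , inj₂ (_ , unstraddled)) zero (suc y) (suc z) _ (s≤s y<z) eq =
  unstraddled y (begin
    last v         ≡⟨ eq ⟩
    lo (init v) z  ≤⟨ lo≤hi (init v) z ⟩
    hi (init v) z  ≤⟨ hi-antitone (init v) z y (<⇒≤ y<z) ⟩
    hi (init v) y  ∎)
  where open ≤-Reasoning

Interval-N-free : ∀ {n} (v : Vec ℕ n) → Admissible v → NFree (Interval v)
Interval-N-free {zero}  v _ (() , _)
Interval-N-free {suc n} v adm
  (a , b , c , d , _ , _ , _ , _ , _ , _ , a≺b , c≺b , c≺d , (_ , c⊀a) , (a⊀d , _) , (_ , d⊀b)) =
  <⇒≱ lo-a<lo-d (Admissible⇒Avoids101ʳ v adm d a point d<a a<point (sym lo-point))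
  where
  open Reach (reach v adm (lo v d) (lo≤top v d))
  d<a : toℕ d < toℕ a
  d<a = ≰⇒> λ a≤d → <⇒≱ (Interval⇒< v a b a≺b)
    (≤-trans (¬Interval⇒≤ v d b d⊀b) (hi-antitone v d a a≤d))
  lo-a<lo-d : lo v a < lo v d
  lo-a<lo-d = ≤-<-trans (¬Interval⇒≤ v c a c⊀a) (Interval⇒< v c d c≺d)
  a<point : toℕ a < toℕ point
  a<point with m≤n⇒m<n∨m≡n (earliest a (¬Interval⇒≤ v a d a⊀d))
  ... | inj₁ lt = lt
  ... | inj₂ eq = ⊥-elim (<-irrefl (trans (cong (lo v) (toℕ-injective eq)) lo-point) lo-a<lo-d)

Interval-CPoset : ∀ {n} (v : Vec ℕ n) → Admissible v → CPoset (Interval v)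
Interval-CPoset v adm =
  (Interval-irreflexive v , Interval-transitive v) , Interval-2+2-free v , Interval-N-free v adm

-- Admissible sequences are the 101-avoiding ascent sequences

lookup-fromℕ : ∀ {A : Set} {n} (v : Vec A (suc n)) → lookup v (fromℕ n) ≡ last v
lookup-fromℕ {n = zero}  (x ∷ []) = refl
lookup-fromℕ {n = suc n} (x ∷ xs) = lookup-fromℕ xs

lookup-inject₁ : ∀ {A : Set} {n} (v : Vec A (suc n)) i → lookup v (inject₁ i) ≡ lookup (init v) i
lookup-inject₁ {n = suc n} (x ∷ xs) zero    = refl
lookup-inject₁ {n = suc n} (x ∷ xs) (suc i) = lookup-inject₁ xs i

take-toList-init : ∀ {A : Set} {n} (v : Vec A (suc n)) k → k ≤ n → take k (toList v) ≡ take k (toList (init v))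
take-toList-init v        zero    _         = refl
take-toList-init (x ∷ xs) (suc k) (s≤s k≤n) = cong (x ∷_) (take-toList-init xs k k≤n)

lookup-opposite : ∀ {n} (v : Vec ℕ n) x → lookup v (opposite x) ≡ lo v x
lookup-opposite {suc n}       v zero    = lookup-fromℕ v
lookup-opposite {suc (suc n)} v (suc x) = trans (lookup-inject₁ v (opposite x)) (lookup-opposite (init v) x)

opposite-reverses-< : ∀ {n} {i j : Fin n} → toℕ i < toℕ j → toℕ (opposite j) < toℕ (opposite i)
opposite-reverses-< {n} {i} {j} i<j =
  subst₂ _<_ (sym (opposite-prop j)) (sym (opposite-prop i)) (∸-monoʳ-< (s≤s i<j) (toℕ<n j))

Avoids101⇒Avoids101ʳ : ∀ {n} (v : Vec ℕ n) → Avoids101 v → Avoids101ʳ v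
Avoids101⇒Avoids101ʳ v avoids x y z x<y y<z lo-x≡lo-z =
  ≤-trans (≤-reflexive lo-x≡lo-z) (≮⇒≥ λ lo-y<lo-z →
    avoids (opposite z) (opposite y) (opposite x) (opposite-reverses-< y<z) (opposite-reverses-< x<y)
      (trans (lookup-opposite v z) (trans (sym lo-x≡lo-z) (sym (lookup-opposite v x))))
      (subst₂ _<_ (sym (lookup-opposite v y)) (sym (lookup-opposite v z)) lo-y<lo-z))

Avoids101ʳ⇒Avoids101 : ∀ {n} (v : Vec ℕ n) → Avoids101ʳ v → Avoids101 v
Avoids101ʳ⇒Avoids101 v avoids i j k i<j j<k vᵢ≡vₖ vⱼ<vᵢ =
  <⇒≱ (subst₂ _<_ (lookup≡lo j) (lookup≡lo k) (subst (lookup v j <_) vᵢ≡vₖ vⱼ<vᵢ))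
      (avoids (opposite k) (opposite j) (opposite i) (opposite-reverses-< j<k) (opposite-reverses-< i<j)
        (trans (sym (lookup≡lo k)) (trans (sym vᵢ≡vₖ) (lookup≡lo i))))
  where
  lookup≡lo : ∀ i → lookup v i ≡ lo v (opposite i)
  lookup≡lo i = trans (cong (lookup v) (sym (opposite-involutive i))) (lookup-opposite v (opposite i))

module _ {n} (v : Vec ℕ (suc (suc n))) where

  private
    prefix-inject₁ : ∀ (j : Fin (suc n)) → take (toℕ (inject₁ j)) (toList v) ≡ take (toℕ j) (toList (init v))
    prefix-inject₁ j = trans (cong (λ k → take k (toList v)) (toℕ-inject₁ j))
                             (take-toList-init v (toℕ j) (<⇒≤ (toℕ<n j)))

    prefix-fromℕ : take (toℕ (fromℕ (suc n))) (toList v) ≡ toList (init v)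
    prefix-fromℕ = begin
      take (toℕ (fromℕ (suc n))) (toList v) ≡⟨ cong (λ k → take k (toList v)) (toℕ-fromℕ (suc n)) ⟩
      take (suc n) (toList v)               ≡⟨ take-toList-init v (suc n) ≤-refl ⟩
      take (suc n) (toList (init v))        ≡⟨ take-all (suc n) _ (≤-reflexive (length-toList (init v))) ⟩
      toList (init v)                       ∎
      where open ≡-Reasoning

  IsAscent-init : IsAscent v → IsAscent (init v)
  IsAscent-init (starts , bounded) =
    (λ j j≡0 → trans (sym (lookup-inject₁ v j)) (starts (inject₁ j) (trans (toℕ-inject₁ j) j≡0))) ,
    (λ j → subst₂ _≤_ (lookup-inject₁ v j) (cong (suc ∘ asc) (prefix-inject₁ j)) (bounded (inject₁ j)))

  IsAscent-last : IsAscent v → last v ≤ suc (asc (toList (init v)))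
  IsAscent-last (_ , bounded) =
    subst₂ _≤_ (lookup-fromℕ v) (cong (suc ∘ asc) prefix-fromℕ) (bounded (fromℕ (suc n)))

  IsAscent-snoc : IsAscent (init v) → last v ≤ suc (asc (toList (init v))) → IsAscent v
  IsAscent-snoc (starts , bounded) last≤ = starts′ , bounded′
    where
    starts′ : ∀ i → toℕ i ≡ 0 → lookup v i ≡ 0
    starts′ i i≡0 with view i
    ... | ‵fromℕ     = case trans (sym (toℕ-fromℕ (suc n))) i≡0 of λ ()
    ... | ‵inject₁ j = trans (lookup-inject₁ v j) (starts j (trans (sym (toℕ-inject₁ j)) i≡0))
    bounded′ : ∀ i → lookup v i ≤ suc (asc (take (toℕ i) (toList v)))
    bounded′ i with view i
    ... | ‵fromℕ     = subst₂ _≤_ (sym (lookup-fromℕ v)) (cong (suc ∘ asc) (sym prefix-fromℕ)) last≤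
    ... | ‵inject₁ j =
      subst₂ _≤_ (sym (lookup-inject₁ v j)) (cong (suc ∘ asc) (sym (prefix-inject₁ j))) (bounded j)

asc-snoc : ∀ {n} (v : Vec ℕ (suc (suc n))) →
           asc (toList v) ≡ asc (toList (init v)) + (if last (init v) <ᵇ last v then 1 else 0)
asc-snoc {zero}  (x ∷ y ∷ [])    = +-comm (if x <ᵇ y then 1 else 0) 0
asc-snoc {suc n} (x ∷ y ∷ z ∷ w) =
  trans (cong ((if x <ᵇ y then 1 else 0) +_) (asc-snoc (y ∷ z ∷ w))) (sym (+-assoc (if x <ᵇ y then 1 else 0) _ _))

-- For an admissible sequence every ascent creates a new maximum.
asc≡top : ∀ {n} (v : Vec ℕ (suc n)) → Admissible v → asc (toList v) ≡ top v
asc≡top {zero}  (x ∷ []) x≡0 = sym x≡0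
asc≡top {suc n} v (adm , inj₁ new) = begin
  asc (toList v)                ≡⟨ asc-snoc v ⟩
  asc (toList (init v)) + _     ≡⟨ cong₂ _+_ (asc≡top (init v) adm) (cong (λ b → if b then 1 else 0) ascent) ⟩
  top (init v) + 1              ≡⟨ +-comm (top (init v)) 1 ⟩
  suc (top (init v))            ≡⟨ top-new v new ⟨
  top v                         ∎
  where
  open ≡-Reasoning
  ascent : (last (init v) <ᵇ last v) ≡ true
  ascent = to T-≡ (<⇒<ᵇ (subst (last (init v) <_) (sym new) (s≤s (lo≤top (init v) zero))))
asc≡top {suc n} v (adm , inj₂ (a≤last , _)) = begin
  asc (toList v)                ≡⟨ asc-snoc v ⟩
  asc (toList (init v)) + _     ≡⟨ cong₂ _+_ (asc≡top (init v) adm) (cong (λ b → if b then 1 else 0) no-ascent) ⟩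
  top (init v) + 0              ≡⟨ +-identityʳ _ ⟩
  top (init v)                  ≡⟨ top-old v a≤last ⟨
  top v                         ∎
  where
  open ≡-Reasoning
  no-ascent : (last (init v) <ᵇ last v) ≡ false
  no-ascent = ¬T⇒≡false λ t → <⇒≱ (<ᵇ⇒< _ _ t) a≤last

Avoids101ʳ⇒AdmissibleStep : ∀ {n} (v : Vec ℕ (suc (suc n))) → Admissible (init v) →
                 last v ≤ suc (top (init v)) → Avoids101ʳ v → AdmissibleStep (init v) (last v)
Avoids101ʳ⇒AdmissibleStep v adm last≤ avoids with m≤n⇒m<n∨m≡n last≤
... | inj₂ new       = inj₁ new
... | inj₁ (s≤s old) = inj₂ (last≤last point lo-point , unstraddled)
  where
  open Reach (reach (init v) adm (last v) old)
  last≤last : ∀ z → lo (init v) z ≡ last v → last v ≤ last (init v)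
  last≤last zero    eq = ≤-reflexive (sym eq)
  last≤last (suc z) eq = avoids zero (suc zero) (suc (suc z)) (s≤s z≤n) (s≤s (s≤s z≤n)) (sym eq)
  unstraddled : Unstraddled (init v) (last v)
  unstraddled y last≤hi with m≤n⇒m<n∨m≡n (earliest y last≤hi)
  ... | inj₁ y<point = avoids zero (suc y) (suc point) (s≤s z≤n) (s≤s y<point) (sym lo-point)
  ... | inj₂ y≡point = ≤-reflexive (sym (trans (cong (lo (init v)) (toℕ-injective y≡point)) lo-point))

IsAscent⇒Admissible : ∀ {n} (v : Vec ℕ n) → IsAscent v → Avoids101ʳ v → Admissible v
IsAscent⇒Admissible {zero}        v        _            _      = tt
IsAscent⇒Admissible {suc zero}    (x ∷ []) (starts , _) _      = starts zero refl
IsAscent⇒Admissible {suc (suc n)} v        ascent       avoids =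
  extend (IsAscent⇒Admissible (init v) (IsAscent-init v ascent)
            λ x y z x<y y<z → avoids (suc x) (suc y) (suc z) (s≤s x<y) (s≤s y<z))
  where
  extend : Admissible (init v) → Admissible v
  extend adm = adm , Avoids101ʳ⇒AdmissibleStep v adm
    (subst (λ m → last v ≤ suc m) (asc≡top (init v) adm) (IsAscent-last v ascent)) avoids

CAsc⇒Admissible : ∀ {n} (v : Vec ℕ n) → CAsc v → Admissible v
CAsc⇒Admissible v (ascent , avoids) = IsAscent⇒Admissible v ascent (Avoids101⇒Avoids101ʳ v avoids)

Admissible⇒IsAscent : ∀ {n} (v : Vec ℕ n) → Admissible v → IsAscent v
Admissible⇒IsAscent {zero}        v        _          = (λ ()) , (λ ())
Admissible⇒IsAscent {suc zero}    (x ∷ []) x≡0        =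
  (λ { zero _ → x≡0 }) , (λ { zero → subst (_≤ 1) (sym x≡0) z≤n })
Admissible⇒IsAscent {suc (suc n)} v        (adm , step) =
  IsAscent-snoc v (Admissible⇒IsAscent (init v) adm)
    (subst (λ m → last v ≤ suc m) (sym (asc≡top (init v) adm)) (bound step))
  where
  bound : AdmissibleStep (init v) (last v) → last v ≤ suc (top (init v))
  bound (inj₁ new)            = ≤-reflexive new
  bound (inj₂ (last≤last , _)) = m≤n⇒m≤1+n (≤-trans last≤last (lo≤top (init v) zero))

Admissible⇒CAsc : ∀ {n} (v : Vec ℕ n) → Admissible v → CAsc v
Admissible⇒CAsc v adm = Admissible⇒IsAscent v adm , Avoids101ʳ⇒Avoids101 v (Admissible⇒Avoids101ʳ v adm)

-- f_AP builds the interval order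

module LevelFacts {k} (lt : BRel k) where
  open Levels lt public

  T-sub : ∀ {x y} → T (sub x y) ⇔ (∀ z → T (lt z x) → T (lt z y))
  T-sub = mk⇔ (λ t z → to T-not∨ (to T-all-allFin t z)) (λ h → from T-all-allFin λ z → from T-not∨ (h z))

  T-rep : ∀ {y} → T (rep y) ⇔ (∀ z → toℕ z < toℕ y → ¬ T (sameD z y))
  T-rep {y} = mk⇔
    (λ t z z<y s → to T-not (to T-all-allFin t z) (from T-∧ (<⇒<ᵇ z<y , s)))
    (λ h → from T-all-allFin λ z → from T-not λ t →
      h z (<ᵇ⇒< (toℕ z) (toℕ y) (proj₁ (to T-∧ t))) (proj₂ (to (T-∧ {toℕ z <ᵇ toℕ y}) t)))

  T-isMax : ∀ {x} → T (isMax x) ⇔ (∀ y → ¬ T (lt x y))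
  T-isMax = mk⇔ (λ t y → to T-not (to T-all-allFin t y)) (λ h → from T-all-allFin λ y → from T-not (h y))

  T-inD : ∀ {a x} → T (inD a x) ⇔ ∃ λ z → level z ≡ a × T (lt x z)
  T-inD {a} = mk⇔
    (λ t → let z , t′ = to T-any-allFin t ; l , r = to (T-∧ {level z ≡ᵇ a}) t′ in z , ≡ᵇ⇒≡ _ _ l , r)
    (λ (z , l , r) → from T-any-allFin (z , from T-∧ (≡⇒≡ᵇ _ _ l , r)))

  level≡count : ∀ x → level x ≡ count (λ y → rep y ∧ sub y x ∧ not (sub x y))
  level≡count x = length-filterᵇ-tabulate (λ y → rep y ∧ sub y x ∧ not (sub x y)) (λ i → i)

module IntervalLevels {n} (v : Vec ℕ (suc n)) (adm : Admissible v)
                      (lt : BRel (suc n)) (lt≗ : ∀ x y → lt x y ≡ Interval v x y) where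
  open LevelFacts lt

  T-lt : ∀ {x y} → T (lt x y) ⇔ hi v x < lo v y
  T-lt {x} {y} = mk⇔ (Interval⇒< v x y ∘ subst T (lt≗ x y)) (subst T (sym (lt≗ x y)) ∘ <⇒Interval v x y)

  T-sub-lo : ∀ {x y} → T (sub x y) ⇔ lo v x ≤ lo v y
  T-sub-lo {x} {y} = mk⇔
    (λ t → ≮⇒≥ λ lo-y<lo-x → let open Reach (reach v adm (lo v y) (lo≤top v y)) in
      <-irrefl hi-point (to T-lt (to T-sub t point (from T-lt (subst (_< lo v x) (sym hi-point) lo-y<lo-x)))))
    (λ lo≤lo → from T-sub λ z z≺x → from T-lt (<-≤-trans (to T-lt z≺x) lo≤lo))

  T-sameD-lo : ∀ {x y} → T (sameD x y) ⇔ lo v x ≡ lo v y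
  T-sameD-lo {x} = mk⇔
    (λ t → ≤-antisym (to T-sub-lo (proj₁ (to T-∧ t))) (to T-sub-lo (proj₂ (to (T-∧ {sub x _}) t))))
    (λ e → from T-∧ (from T-sub-lo (≤-reflexive e) , from T-sub-lo (≤-reflexive (sym e))))

  T-rep-lo : ∀ {y} → T (rep y) ⇔ (∀ z → toℕ z < toℕ y → lo v z ≢ lo v y)
  T-rep-lo = mk⇔ (λ t z z<y e → to T-rep t z z<y (from T-sameD-lo e))
                 (λ h → from T-rep λ z z<y s → h z z<y (to T-sameD-lo s))

  level≡lo : ∀ x → level x ≡ lo v x
  level≡lo x = begin
    level x                                        ≡⟨ level≡count x ⟩
    count (λ y → rep y ∧ sub y x ∧ not (sub x y))  ≡⟨ count-cong (λ y → cong (rep y ∧_) (strictly-below y)) ⟩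
    count (λ y → rep y ∧ (lo v y <ᵇ lo v x))       ≡⟨ count-first-< (lo v) rep (λ _ → T-rep-lo) (lo v x) attained ⟩
    lo v x                                         ∎
    where
    open ≡-Reasoning
    strictly-below : ∀ y → (sub y x ∧ not (sub x y)) ≡ (lo v y <ᵇ lo v x)
    strictly-below y = T-ext
      (λ t → <⇒<ᵇ (≤∧≢⇒< (to T-sub-lo (proj₁ (to T-∧ t)))
                          λ e → to T-not (proj₂ (to (T-∧ {sub y x}) t)) (from T-sub-lo (≤-reflexive (sym e)))))
      (λ t → let y<x = <ᵇ⇒< (lo v y) (lo v x) t in
        from T-∧ (from T-sub-lo (<⇒≤ y<x) , from T-not λ s → <⇒≱ y<x (to T-sub-lo s)))
    attained : ∀ t → t < lo v x → ∃ λ z → lo v z ≡ t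
    attained t t<lo = point , lo-point
      where open Reach (reach v adm t (≤-trans (<⇒≤ t<lo) (lo≤top v x)))

  T-isMax-hi : ∀ {x} → T (isMax x) ⇔ hi v x ≡ top v
  T-isMax-hi {x} = mk⇔
    (λ t → ≤-antisym (hi≤top v x) (≮⇒≥ λ hi<top → let open Reach (reach v adm (top v) ≤-refl) in
      to T-isMax t point (from T-lt (subst (hi v x <_) (sym lo-point) hi<top))))
    (λ hi≡top → from T-isMax λ y → Interval-maximal v x hi≡top y ∘ subst T (lt≗ x y))

  ell≡top : ell ≡ top v
  ell≡top = foldr-⊔-≡ (map level (allFin _))
    (All.map⁺ (tabulate⁺ λ x → subst (_≤ top v) (sym (level≡lo x)) (lo≤top v x)))
    (Any.map⁺ (lose (∈-allFin point) (≤-reflexive (sym (trans (level≡lo point) lo-point)))))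
    where open Reach (reach v adm (top v) ≤-refl)

  ellStar≡last : ellStar ≡ last v
  ellStar≡last = foldr-⊓-≡ (map level (filterᵇ isMax (allFin _)))
    (subst (last v ≤_) (sym ell≡top) (lo≤top v zero))
    (All.map⁺ (All.tabulate λ {x} x∈maxima → subst (last v ≤_) (sym (level≡lo x))
      (last≤lo-of-top v adm x (to T-isMax-hi (proj₂ (∈-filter⁻ (T? ∘ isMax) x∈maxima))))))
    (Any.map⁺ (lose (∈-filter⁺ (T? ∘ isMax) (∈-allFin zero) (from T-isMax-hi refl))
                    (≤-reflexive (level≡lo zero))))

  inD≡ : ∀ a x → a ≤ top v → inD a x ≡ (hi v x <ᵇ a)
  inD≡ a x a≤top = T-ext
    (λ t → let z , level≡a , x≺z = to T-inD t in
      <⇒<ᵇ (subst (hi v x <_) (trans (sym (level≡lo z)) level≡a) (to T-lt x≺z)))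
    (λ t → from T-inD (point , trans (level≡lo point) lo-point ,
      from T-lt (subst (hi v x <_) (sym lo-point) (<ᵇ⇒< (hi v x) a t))))
    where open Reach (reach v adm a a≤top)

-- b₁ and b₂ are the tests for (AP1) and (AP2) in the definition of step.
if-AP1 : ∀ {b₁} b₂ (x : Bool) → b₁ ≡ true → (if b₁ then x else (if b₂ then true else x)) ≡ x
if-AP1 _ _ refl = refl

if-AP2 : ∀ {b₁ b₂} (x : Bool) → b₁ ≡ false → b₂ ≡ true →
         (if b₁ then x else (if b₂ then true else x)) ≡ true
if-AP2 _ refl refl = refl

if-not-AP3 : ∀ {b₁ b₂} (x : Bool) → b₁ ≡ true ⊎ b₂ ≡ true →
             (if b₁ then false else (if b₂ then false else x)) ≡ false
if-not-AP3 {true}          _ _          = refl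
if-not-AP3 {false} {true}  _ _          = refl
if-not-AP3 {false} {false} _ (inj₁ ())
if-not-AP3 {false} {false} _ (inj₂ ())

module _ {n} (v : Vec ℕ (suc (suc n))) (adm : Admissible (init v))
         (lt : BRel (suc n)) (lt≗ : ∀ x y → lt x y ≡ Interval (init v) x y) where
  open Levels lt using (ell; ellStar; inD; isMax; level)
  open IntervalLevels (init v) adm lt lt≗

  private
    AP1 : last v ≤ last (init v) → (last v ≤ᵇ ellStar) ≡ true
    AP1 last≤last = trans (cong (last v ≤ᵇ_) ellStar≡last) (to T-≡ (≤⇒≤ᵇ last≤last))

    AP2 : last v ≡ suc (top (init v)) → (last v ≡ᵇ suc ell) ≡ true
    AP2 new = trans (cong (λ e → last v ≡ᵇ suc e) ell≡top) (to T-≡ (≡⇒≡ᵇ _ _ new))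

    AP2⇒¬AP1 : last v ≡ suc (top (init v)) → (last v ≤ᵇ ellStar) ≡ false
    AP2⇒¬AP1 new = trans (cong (last v ≤ᵇ_) ellStar≡last) (¬T⇒≡false λ t →
      <⇒≱ (subst (last (init v) <_) (sym new) (s≤s (lo≤top (init v) zero))) (≤ᵇ⇒≤ (last v) (last (init v)) t))

    old-pairs : (last v ≤ᵇ ellStar) ≡ true ⊎ (last v ≡ᵇ suc ell) ≡ true →
                ∀ x y → step lt (last v) (suc x) (suc y) ≡ Interval (init v) x y
    old-pairs not-AP3 x y = begin
      lt x y ∨ _
        ≡⟨ cong (lt x y ∨_) (if-not-AP3 (isMax x ∧ (level x <ᵇ last v) ∧ (last v ≤ᵇ level y)) not-AP3) ⟩
      lt x y ∨ false
        ≡⟨ ∨-identityʳ (lt x y) ⟩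
      lt x y
        ≡⟨ lt≗ x y ⟩
      Interval (init v) x y ∎
      where open ≡-Reasoning

  step≗Interval : AdmissibleStep (init v) (last v) → ∀ x y → step lt (last v) x y ≡ Interval v x y
  step≗Interval _ zero y = sym (¬T⇒≡false λ t → <⇒≱ (Interval⇒< v zero y t) (lo≤top v y))
  step≗Interval (inj₁ new) (suc x) zero = trans (if-AP2 (inD (last v) x) (AP2⇒¬AP1 new) (AP2 new))
    (sym (to T-≡ (<⇒<ᵇ (subst (hi (init v) x <_) (sym new) (s≤s (hi≤top (init v) x))))))
  step≗Interval (inj₁ new) (suc x) (suc y) = old-pairs (inj₂ (AP2 new)) x y
  step≗Interval (inj₂ (last≤last , _)) (suc x) zero =
    trans (if-AP1 (last v ≡ᵇ suc ell) (inD (last v) x) (AP1 last≤last))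
          (inD≡ (last v) x (≤-trans last≤last (lo≤top (init v) zero)))
  step≗Interval (inj₂ (last≤last , _)) (suc x) (suc y) = old-pairs (inj₁ (AP1 last≤last)) x y

fAP≗Interval : ∀ {n} (v : Vec ℕ n) → Admissible v → ∀ x y → fAP v x y ≡ Interval v x y
fAP≗Interval {suc zero}    v _            zero zero = sym (Interval-irreflexive v zero)
fAP≗Interval {suc (suc n)} v (adm , a-step)          =
  step≗Interval v adm (fAP (init v)) (fAP≗Interval (init v) adm) a-step

module _ {m n} {P : BRel m} {Q : BRel n} (f : Fin m → Fin n) (f-injective : ∀ {x y} → f x ≡ f y → x ≡ y)
         (P≗Q∘f : ∀ x y → P x y ≡ Q (f x) (f y)) where
  private
    ≺⇒ : ∀ {x y} → T (P x y) → T (Q (f x) (f y))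
    ≺⇒ {x} {y} = subst T (P≗Q∘f x y)

    ⊀⇒ : ∀ {x y} → ¬ T (P x y) → ¬ T (Q (f x) (f y))
    ⊀⇒ {x} {y} x⊀y = x⊀y ∘ subst T (sym (P≗Q∘f x y))

    ∥⇒ : ∀ {x y} → Incomp P x y → Incomp Q (f x) (f y)
    ∥⇒ (x⊀y , y⊀x) = ⊀⇒ x⊀y , ⊀⇒ y⊀x

    ≢⇒ : ∀ {x y} → x ≢ y → f x ≢ f y
    ≢⇒ x≢y = x≢y ∘ f-injective

  CPoset-pullback : CPoset Q → CPoset P
  CPoset-pullback ((irreflexive , transitive) , no-2+2 , no-N) =
    ((λ x → trans (P≗Q∘f x x) (irreflexive (f x))) ,
     (λ x y z x≺y y≺z → subst T (sym (P≗Q∘f x z)) (transitive _ _ _ (≺⇒ x≺y) (≺⇒ y≺z)))) ,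
    (λ (a , b , c , d , a≢b , a≢c , a≢d , b≢c , b≢d , c≢d , a≺b , c≺d , a∥c , a∥d , b∥c , b∥d) →
      no-2+2 (f a , f b , f c , f d , ≢⇒ a≢b , ≢⇒ a≢c , ≢⇒ a≢d , ≢⇒ b≢c , ≢⇒ b≢d , ≢⇒ c≢d ,
              ≺⇒ a≺b , ≺⇒ c≺d , ∥⇒ a∥c , ∥⇒ a∥d , ∥⇒ b∥c , ∥⇒ b∥d)) ,
    (λ (a , b , c , d , a≢b , a≢c , a≢d , b≢c , b≢d , c≢d , a≺b , c≺b , c≺d , a∥c , a∥d , b∥d) →
      no-N (f a , f b , f c , f d , ≢⇒ a≢b , ≢⇒ a≢c , ≢⇒ a≢d , ≢⇒ b≢c , ≢⇒ b≢d , ≢⇒ c≢d ,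
            ≺⇒ a≺b , ≺⇒ c≺b , ≺⇒ c≺d , ∥⇒ a∥c , ∥⇒ a∥d , ∥⇒ b∥d))

CAsc⇒CPoset : ∀ {n} (v : Vec ℕ n) → CAsc v → CPoset (fAP v)
CAsc⇒CPoset v c = CPoset-pullback (λ x → x) (λ eq → eq) (fAP≗Interval v adm) (Interval-CPoset v adm)
  where adm = CAsc⇒Admissible v c

-- Isomorphic interval orders come from equal sequences

Iso-≗ : ∀ {n} {P Q : BRel n} → (∀ x y → P x y ≡ Q x y) → Iso P Q
Iso-≗ P≗Q = Perm.id , P≗Q

Iso-sym : ∀ {n} {P Q : BRel n} → Iso P Q → Iso Q P
Iso-sym {Q = Q} (σ , σ-pres) = Perm.flip σ , λ x y →
  sym (trans (σ-pres (σ ⟨$⟩ˡ x) (σ ⟨$⟩ˡ y)) (cong₂ Q (inverseʳ σ) (inverseʳ σ)))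

Iso-trans : ∀ {n} {P Q R : BRel n} → Iso P Q → Iso Q R → Iso P R
Iso-trans (σ , σ-pres) (τ , τ-pres) = σ ∘ₚ τ , λ x y → trans (σ-pres x y) (τ-pres _ _)

Iso-resp-≗ : ∀ {n} {P P′ Q Q′ : BRel n} → (∀ x y → P x y ≡ P′ x y) → (∀ x y → Q x y ≡ Q′ x y) →
             Iso P Q → Iso P′ Q′
Iso-resp-≗ P≗P′ Q≗Q′ (σ , σ-pres) = σ , λ x y →
  trans (sym (P≗P′ x y)) (trans (σ-pres x y) (Q≗Q′ (σ ⟨$⟩ʳ x) (σ ⟨$⟩ʳ y)))

Iso-tail : ∀ {n} {P Q : BRel (suc n)} (iso : Iso P Q) → proj₁ iso ⟨$⟩ʳ zero ≡ zero →
           Iso (λ x y → P (suc x) (suc y)) (λ x y → Q (suc x) (suc y))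
Iso-tail {Q = Q} (σ , σ-pres) σ0≡0 = remove zero σ , λ x y →
  trans (σ-pres (suc x) (suc y)) (sym (cong₂ Q (lift₀-remove σ σ0≡0 (suc x)) (lift₀-remove σ σ0≡0 (suc y))))

permutation-injective : ∀ {n} (π : Permutation′ n) {x y} → π ⟨$⟩ʳ x ≡ π ⟨$⟩ʳ y → x ≡ y
permutation-injective π eq = trans (sym (inverseˡ π)) (trans (cong (π ⟨$⟩ˡ_) eq) (inverseˡ π))

transpose-sends : ∀ {k} (i j : Fin k) → PC.transpose i j i ≡ j
transpose-sends i j with i ≟ᶠ i
... | yes _  = refl
... | no i≢i = ⊥-elim (i≢i refl)

transpose-preserves : ∀ {k} {A : Set} (h : Fin k → A) {i j} → h i ≡ h j → ∀ x → h (PC.transpose i j x) ≡ h x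
transpose-preserves h {i} {j} hi≡hj x with x ≟ᶠ i
... | yes refl = sym hi≡hj
... | no _ with x ≟ᶠ j
...   | yes refl = hi≡hj
...   | no _     = refl

Interval-transposition : ∀ {n} (v : Vec ℕ n) i j → lo v i ≡ lo v j → hi v i ≡ hi v j →
                         Iso (Interval v) (Interval v)
Interval-transposition v i j lo≡ hi≡ = Perm.transpose i j , λ x y →
  sym (cong₂ _<ᵇ_ (transpose-preserves (hi v) hi≡ x) (transpose-preserves (lo v) lo≡ y))

module IntervalHom {n} {u v : Vec ℕ (suc n)} (adm : Admissible u) (iso : Iso (Interval u) (Interval v)) where
  private
    σ = proj₁ iso

    ≺-preserved : ∀ x y → T (Interval u x y) → hi v (σ ⟨$⟩ʳ x) < lo v (σ ⟨$⟩ʳ y)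
    ≺-preserved x y x≺y = Interval⇒< v (σ ⟨$⟩ʳ x) (σ ⟨$⟩ʳ y) (subst T (proj₂ iso x y) x≺y)

    ⊀-preserved : ∀ x y → ¬ T (Interval u x y) → lo v (σ ⟨$⟩ʳ y) ≤ hi v (σ ⟨$⟩ʳ x)
    ⊀-preserved x y x⊀y = ¬Interval⇒≤ v (σ ⟨$⟩ʳ x) (σ ⟨$⟩ʳ y) (x⊀y ∘ subst T (sym (proj₂ iso x y)))

  lo-≤ : ∀ x → lo u x ≤ lo v (σ ⟨$⟩ʳ x)
  lo-≤ x = go (lo u x) x refl
    where
    go : ∀ t x → lo u x ≡ t → t ≤ lo v (σ ⟨$⟩ʳ x)
    go zero    x _     = z≤n
    go (suc t) x lo≡t = ≤-<-trans (≤-trans (go t point lo-point) (lo≤hi v (σ ⟨$⟩ʳ point)))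
      (≺-preserved point x (<⇒Interval u point x (subst₂ _<_ (sym hi-point) (sym lo≡t) ≤-refl)))
      where open Reach (reach u adm t (≤-trans (n≤1+n t) (subst (_≤ top u) lo≡t (lo≤top u x))))

  hi-≤ : ∀ x → hi u x ≤ hi v (σ ⟨$⟩ʳ x)
  hi-≤ x = begin
    hi u x             ≡⟨ lo-point ⟨
    lo u point         ≤⟨ lo-≤ point ⟩
    lo v (σ ⟨$⟩ʳ point) ≤⟨ ⊀-preserved x point (<-irrefl (sym lo-point) ∘ Interval⇒< u x point) ⟩
    hi v (σ ⟨$⟩ʳ x)     ∎
    where
    open ≤-Reasoning
    open Reach (reach u adm (hi u x) (hi≤top u x))

module IntervalIso {n} {u v : Vec ℕ (suc n)} (adm-u : Admissible u) (adm-v : Admissible v)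
                   (iso : Iso (Interval u) (Interval v)) where
  private
    σ = proj₁ iso
    module U = IntervalHom adm-u iso
    module V = IntervalHom adm-v (Iso-sym iso)

  lo-preserved : ∀ x → lo u x ≡ lo v (σ ⟨$⟩ʳ x)
  lo-preserved x =
    ≤-antisym (U.lo-≤ x) (subst (λ y → lo v (σ ⟨$⟩ʳ x) ≤ lo u y) (inverseˡ σ) (V.lo-≤ (σ ⟨$⟩ʳ x)))

  hi-preserved : ∀ x → hi u x ≡ hi v (σ ⟨$⟩ʳ x)
  hi-preserved x =
    ≤-antisym (U.hi-≤ x) (subst (λ y → hi v (σ ⟨$⟩ʳ x) ≤ hi u y) (inverseˡ σ) (V.hi-≤ (σ ⟨$⟩ʳ x)))

  top-preserved : top u ≡ top v
  top-preserved = ≤-antisym (≤-trans (U.hi-≤ zero) (hi≤top v (σ ⟨$⟩ʳ zero)))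
                            (≤-trans (V.hi-≤ zero) (hi≤top u (σ ⟨$⟩ˡ zero)))

  last-≥ : last v ≤ last u
  last-≥ = subst (last v ≤_) (sym (lo-preserved zero))
    (last≤lo-of-top v adm-v (σ ⟨$⟩ʳ zero) (trans (sym (hi-preserved zero)) top-preserved))

Interval-Iso-last : ∀ {n} {u v : Vec ℕ (suc n)} → Admissible u → Admissible v →
                    Iso (Interval u) (Interval v) → last u ≡ last v
Interval-Iso-last adm-u adm-v iso =
  ≤-antisym (IntervalIso.last-≥ adm-v adm-u (Iso-sym iso)) (IntervalIso.last-≥ adm-u adm-v iso)

Interval-Iso-init : ∀ {n} {u v : Vec ℕ (suc (suc n))} → Admissible u → Admissible v →
                    Iso (Interval u) (Interval v) → Iso (Interval (init u)) (Interval (init v))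
Interval-Iso-init {u = u} {v = v} adm-u adm-v iso =
  Iso-tail {P = Interval u} {Q = Interval v}
    (Iso-trans {R = Interval v} iso (Interval-transposition v (σ ⟨$⟩ʳ zero) zero lo≡ hi≡))
    (transpose-sends (σ ⟨$⟩ʳ zero) zero)
  where
  open IntervalIso adm-u adm-v iso
  σ = proj₁ iso
  lo≡ : lo v (σ ⟨$⟩ʳ zero) ≡ lo v zero
  lo≡ = trans (sym (lo-preserved zero)) (Interval-Iso-last adm-u adm-v iso)
  hi≡ : hi v (σ ⟨$⟩ʳ zero) ≡ hi v zero
  hi≡ = trans (sym (hi-preserved zero)) top-preserved

init-last-injective : ∀ {A : Set} {n} (u v : Vec A (suc n)) → init u ≡ init v → last u ≡ last v → u ≡ v
init-last-injective u v init≡ last≡ = begin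
  u                 ≡⟨ proj₂ (proj₂ (initLast u)) ⟩
  init u ∷ʳ last u  ≡⟨ cong₂ _∷ʳ_ init≡ last≡ ⟩
  init v ∷ʳ last v  ≡⟨ proj₂ (proj₂ (initLast v)) ⟨
  v                 ∎
  where open ≡-Reasoning

Interval-injective : ∀ {n} (u v : Vec ℕ n) → Admissible u → Admissible v → Iso (Interval u) (Interval v) → u ≡ v
Interval-injective {zero}        []       []       _     _     _   = refl
Interval-injective {suc zero}    (x ∷ []) (y ∷ []) x≡0   y≡0   _   = cong (_∷ []) (trans x≡0 (sym y≡0))
Interval-injective {suc (suc n)} u        v        adm-u adm-v iso = init-last-injective u v
  (Interval-injective (init u) (init v) (proj₁ adm-u) (proj₁ adm-v) (Interval-Iso-init adm-u adm-v iso))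
  (Interval-Iso-last adm-u adm-v iso)

-- Every (2+2)- and N-free poset is an interval order of an admissible sequence

module _ {k} (_≼_ : Fin k → Fin k → Set) (≼-trans : ∀ {x y z} → x ≼ y → y ≼ z → x ≼ z)
         {Q : Fin k → Set} (Q? : ∀ x → Dec (Q x)) (≼-total : ∀ {x y} → Q x → Q y → x ≼ y ⊎ y ≼ x) where

  private
    scan : ∀ xs {c} → Q c → Σ (Fin k) λ m → Q m × All (λ x → Q x → m ≼ x) xs
    scan []       {c} qc = c , qc , []
    scan (x ∷ xs)     qc with scan xs qc | Q? x
    ... | m , qm , m≼xs | no ¬qx = m , qm , (λ qx → ⊥-elim (¬qx qx)) ∷ m≼xs
    ... | m , qm , m≼xs | yes qx with ≼-total qm qx
    ...   | inj₁ m≼x = m , qm , (λ _ → m≼x) ∷ m≼xs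
    ...   | inj₂ x≼m =
      x , qx , (λ _ → [ id , id ] (≼-total qx qx)) ∷ All.map (λ m≼ q → ≼-trans x≼m (m≼ q)) m≼xs

  minimum : ∀ {c} → Q c → Σ (Fin k) λ m → Q m × ∀ x → Q x → m ≼ x
  minimum qc with scan (allFin k) qc
  ... | m , qm , m≼ = m , qm , λ x → All.lookup m≼ (∈-allFin x)

-- The element added by the last step of f_AP has this property: it lies on level ℓ⋆.
LowestMaximal : ∀ {n} → BRel n → Fin n → Set
LowestMaximal P m = Maximal P m × (∀ y → Maximal P y → ∀ z → T (P z m) → T (P z y))

LowestMaximal-pullback : ∀ {n} {P : BRel n} (π : Permutation′ n) {i} →
                         LowestMaximal P (π ⟨$⟩ʳ i) → LowestMaximal (λ x y → P (π ⟨$⟩ʳ x) (π ⟨$⟩ʳ y)) i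
LowestMaximal-pullback {P = P} π (maximal , lowest) =
  (λ y → maximal (π ⟨$⟩ʳ y)) ,
  (λ y y-maximal z → lowest (π ⟨$⟩ʳ y)
    (λ w → subst (λ w → ¬ T (P (π ⟨$⟩ʳ y) w)) (inverseʳ π) (y-maximal (π ⟨$⟩ˡ w))) (π ⟨$⟩ʳ z))

module Chains {k} {P : BRel k} (poset : IsStrictPoset P) (no-2+2 : TwoPlusTwoFree P) where
  private
    ≺⇒≢ : ∀ {x y} → T (P x y) → x ≢ y
    ≺⇒≢ {x} x≺x refl = subst T (proj₁ poset x) x≺x

    _⨾_ : ∀ {x y z} → T (P x y) → T (P y z) → T (P x z)
    _⨾_ = proj₂ poset _ _ _

  no-crossing : ∀ {x a y b} → T (P x a) → T (P y b) → ¬ T (P y a) → ¬ T (P x b) → ⊥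
  no-crossing {x} {a} {y} {b} x≺a y≺b y⊀a x⊀b = no-2+2
    (x , a , y , b , ≺⇒≢ x≺a , x≢y , x≢b , a≢y , a≢b , ≺⇒≢ y≺b , x≺a , y≺b ,
     ((λ x≺y → x⊀b (x≺y ⨾ y≺b)) , (λ y≺x → y⊀a (y≺x ⨾ x≺a))) ,
     (x⊀b , (λ b≺x → y⊀a (y≺b ⨾ (b≺x ⨾ x≺a)))) ,
     ((λ a≺y → x⊀b (x≺a ⨾ (a≺y ⨾ y≺b))) , y⊀a) ,
     ((λ a≺b → x⊀b (x≺a ⨾ a≺b)) , (λ b≺a → y⊀a (y≺b ⨾ b≺a))))
    where
    x≢y : x ≢ y
    x≢y refl = y⊀a x≺a
    x≢b : x ≢ b
    x≢b refl = y⊀a (y≺b ⨾ x≺a)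
    a≢y : a ≢ y
    a≢y refl = x⊀b (x≺a ⨾ y≺b)
    a≢b : a ≢ b
    a≢b refl = x⊀b x≺a

  upsets-chain : ∀ x y → (∀ z → T (P x z) → T (P y z)) ⊎ (∀ z → T (P y z) → T (P x z))
  upsets-chain x y with all? (λ z → T? (P x z) →-dec T? (P y z))
  ... | yes ⊆ = inj₁ ⊆
  ... | no ⊈ with ¬∀⟶∃¬ k _ (λ z → T? (P x z) →-dec T? (P y z)) ⊈
  ...   | a , x≺a⇏y≺a with ¬-implication x≺a⇏y≺a
  ...     | x≺a , y⊀a = inj₂ λ b y≺b → case T? (P x b) of λ where
    (yes x≺b) → x≺b
    (no x⊀b)  → ⊥-elim (no-crossing x≺a y≺b y⊀a x⊀b)

  downsets-chain : ∀ x y → (∀ z → T (P z x) → T (P z y)) ⊎ (∀ z → T (P z y) → T (P z x))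
  downsets-chain x y with all? (λ z → T? (P z x) →-dec T? (P z y))
  ... | yes ⊆ = inj₁ ⊆
  ... | no ⊈ with ¬∀⟶∃¬ k _ (λ z → T? (P z x) →-dec T? (P z y)) ⊈
  ...   | a , a≺x⇏a≺y with ¬-implication a≺x⇏a≺y
  ...     | a≺x , a⊀y = inj₂ λ b b≺y → case T? (P b x) of λ where
    (yes b≺x) → b≺x
    (no b⊀x)  → ⊥-elim (no-crossing a≺x b≺y b⊀x a⊀y)

lowest-maximal : ∀ {k} (P : BRel (suc k)) → IsStrictPoset P → TwoPlusTwoFree P → ∃ (LowestMaximal P)
lowest-maximal {k} P poset no-2+2 = minimum (λ x y → ∀ z → T (P z x) → T (P z y)) (λ p q z → q z ∘ p z)
  (λ x → all? (λ y → ¬? (T? (P x y)))) (λ {x} {y} _ _ → downsets-chain x y) m₀-maximal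
  where
  open Chains poset no-2+2
  m₀ : Σ (Fin (suc k)) λ m₀ → ⊤ × ∀ x → ⊤ → ∀ z → T (P m₀ z) → T (P x z)
  m₀ = minimum (λ x y → ∀ z → T (P x z) → T (P y z)) (λ p q z → q z ∘ p z) (λ _ → yes tt)
               (λ {x} {y} _ _ → upsets-chain x y) {c = zero} tt
  -- Having the fewest upper bounds, m₀ has none at all.
  m₀-maximal : Maximal P (proj₁ m₀)
  m₀-maximal z m₀≺z = subst T (proj₁ poset z) (proj₂ (proj₂ m₀) z tt z m₀≺z)

-- D is the downset of a new element to be put on top of Interval v.
module Threshold {n} (v : Vec ℕ (suc n)) (adm : Admissible v) {D : Fin (suc n) → Set} (D? : ∀ y → Dec (D y))
  (down-closed   : ∀ {x y} → D x → T (Interval v y x) → D y)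
  (no-N          : ∀ {x y r} → T (Interval v y r) → T (Interval v x r) → D x → Incomp (Interval v) y x →
                   ¬ D y → ¬ D r → ⊥)
  (below-maximal : ∀ {x y} → hi v y ≡ top v → ¬ D y → D x → T (Interval v x y)) where

  private
    maximal-outside : ∀ {y} → ¬ D y → Σ (Fin (suc n)) λ r → hi v r ≡ top v × ¬ D r
    maximal-outside {y} ¬dy with m≤n⇒m<n∨m≡n (hi≤top v y)
    ... | inj₂ hi≡top = y , hi≡top , ¬dy
    ... | inj₁ hi<top = point , hi-point , λ dr →
      ¬dy (down-closed dr (<⇒Interval v y point (subst (hi v y <_) (sym lo-point) hi<top)))
      where open Reach (reach v adm (top v) ≤-refl)

    full-if-top : ∀ {x y} → D x → hi v x ≡ top v → ¬ D y → ⊥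
    full-if-top {x} dx hi≡top ¬dy =
      let r , hi-r≡top , ¬dr = maximal-outside ¬dy in Interval-maximal v x hi≡top r (below-maximal hi-r≡top ¬dr dx)

    -- An interval above both x and y would complete an N with the new element.
    no-common-upper : ∀ {x y} → D x → ¬ D y → Incomp (Interval v) y x → hi v x ⊔ hi v y < top v → ⊥
    no-common-upper {x} {y} dx ¬dy y∥x bound =
      no-N {r = point} (above y (m≤n⊔m (hi v x) (hi v y))) (above x (m≤m⊔n (hi v x) (hi v y))) dx y∥x ¬dy
        (λ dr → ¬dy (down-closed dr (above y (m≤n⊔m (hi v x) (hi v y)))))
      where
      open Reach (reach v adm (suc (hi v x ⊔ hi v y)) bound)
      above : ∀ z → hi v z ≤ hi v x ⊔ hi v y → T (Interval v z point)
      above z le = <⇒Interval v z point (subst (hi v z <_) (sym lo-point) (s≤s le))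

  module Cut (z : Fin (suc n)) (¬dz : ¬ D z) (z-least : ∀ y → ¬ D y → hi v z ≤ hi v y) where
    D⇒< : ∀ {x} → D x → hi v x < hi v z
    D⇒< {x} dx = ≰⇒> λ hi-z≤hi-x → case m≤n⇒m<n∨m≡n (hi≤top v x) of λ where
      (inj₂ hi≡top) → full-if-top dx hi≡top ¬dz
      (inj₁ hi<top) → no-common-upper dx ¬dz
        ((¬dz ∘ down-closed dx) , (λ x≺z → <⇒≱ (Interval⇒< v x z x≺z) (≤-trans (lo≤hi v z) hi-z≤hi-x)))
        (subst (_< top v) (sym (m≥n⇒m⊔n≡m hi-z≤hi-x)) hi<top)

    <⇒D : ∀ {y} → hi v y < hi v z → D y
    <⇒D {y} hi<a = decidable-stable (D? y) λ ¬dy → <⇒≱ hi<a (z-least y ¬dy)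

    ≤last : hi v z ≤ last v
    ≤last = subst (hi v z ≤_) hi-point (z-least point ¬d-point)
      where
      open Reach (reach v adm (last v) (lo≤top v zero))
      ¬d-zero : ¬ D zero
      ¬d-zero d₀ = <⇒≱ (D⇒< d₀) (hi≤top v z)
      ¬d-point : ¬ D point
      ¬d-point d = <-irrefl hi-point (Interval⇒< v point zero (below-maximal refl ¬d-zero d))

    unstraddled : Unstraddled v (hi v z)
    unstraddled j a≤hi-j = ≮⇒≥ λ lo-j<a → case m≤n⇒m<n∨m≡n (hi≤top v j) of λ where
        (inj₂ hi≡top) → <-irrefl hi-point (Interval⇒< v point j (below-maximal hi≡top ¬dj (d-point lo-j<a)))
        (inj₁ hi<top) → no-common-upper (d-point lo-j<a) ¬dj (j⊀point , point⊀j)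
          (subst (_< top v) (sym (m≤n⇒m⊔n≡n (subst (_≤ hi v j) (sym hi-point) (lo≤hi v j)))) hi<top)
      where
      open Reach (reach v adm (lo v j) (lo≤top v j))
      d-point : lo v j < hi v z → D point
      d-point lo-j<a = <⇒D (subst (_< hi v z) (sym hi-point) lo-j<a)
      ¬dj : ¬ D j
      ¬dj dj = <⇒≱ (D⇒< dj) a≤hi-j
      j⊀point : ¬ T (Interval v j point)
      j⊀point j≺point = <⇒≱ (Interval⇒< v j point j≺point) (subst (_≤ hi v j) (sym lo-point) (lo≤hi v j))
      point⊀j : ¬ T (Interval v point j)
      point⊀j point≺j = <-irrefl hi-point (Interval⇒< v point j point≺j)

  threshold : Σ ℕ λ a → (∀ y → D y ⇔ hi v y < a) × AdmissibleStep v a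
  threshold with all? D?
  ... | yes all-D = suc (top v) , (λ y → mk⇔ (λ _ → s≤s (hi≤top v y)) (λ _ → all-D y)) , inj₁ refl
  ... | no ¬all-D with minimum (λ x y → hi v x ≤ hi v y) ≤-trans (λ x → ¬? (D? x))
                         (λ {x} {y} _ _ → ≤-total (hi v x) (hi v y)) (proj₂ (¬∀⟶∃¬ (suc n) D D? ¬all-D))
  ...   | z , ¬dz , z-least = hi v z , (λ y → mk⇔ D⇒< <⇒D) , inj₂ (≤last , unstraddled)
    where open Cut z ¬dz z-least

Admissible-∷ʳ : ∀ {n} {v : Vec ℕ (suc n)} {a} → Admissible v → AdmissibleStep v a → Admissible (v ∷ʳ a)
Admissible-∷ʳ {v = v} {a} adm a-step =
  subst Admissible (sym (init-∷ʳ a v)) adm , subst₂ AdmissibleStep (sym (init-∷ʳ a v)) (sym (last-∷ʳ a v)) a-step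

module Extension {k} (v : Vec ℕ (suc k)) (adm : Admissible v) {Q : BRel (suc (suc k))} (cpQ : CPoset Q)
                 (tail≗ : ∀ x y → Q (suc x) (suc y) ≡ Interval v x y) (lowest : LowestMaximal Q zero) where
  private
    D : Fin (suc k) → Set
    D y = T (Q (suc y) zero)

    ≺⇒ : ∀ {x y} → T (Interval v x y) → T (Q (suc x) (suc y))
    ≺⇒ {x} {y} = subst T (sym (tail≗ x y))

    ⊀⇒ : ∀ {x y} → ¬ T (Interval v x y) → ¬ T (Q (suc x) (suc y))
    ⊀⇒ {x} {y} x⊀y = x⊀y ∘ subst T (tail≗ x y)

    ≺⇒≢ : ∀ {x y} → T (Q x y) → x ≢ y
    ≺⇒≢ {x} x≺x refl = subst T (proj₁ (proj₁ cpQ) x) x≺x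

    down-closed : ∀ {x y} → D x → T (Interval v y x) → D y
    down-closed dx y≺x = proj₂ (proj₁ cpQ) _ _ _ (≺⇒ y≺x) dx

    no-N : ∀ {x y r} → T (Interval v y r) → T (Interval v x r) → D x → Incomp (Interval v) y x →
           ¬ D y → ¬ D r → ⊥
    no-N {x} {y} {r} y≺r x≺r dx (y⊀x , x⊀y) ¬dy ¬dr = proj₂ (proj₂ cpQ)
      (suc y , suc r , suc x , zero , ≺⇒≢ (≺⇒ y≺r) , (¬dy ∘ λ { refl → dx }) , (λ ()) ,
       (¬dr ∘ λ { refl → dx }) , (λ ()) , ≺⇒≢ dx ,
       ≺⇒ y≺r , ≺⇒ x≺r , dx , (⊀⇒ y⊀x , ⊀⇒ x⊀y) ,
       (¬dy , proj₁ lowest (suc y)) , (¬dr , proj₁ lowest (suc r)))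

    below-maximal : ∀ {x y} → hi v y ≡ top v → ¬ D y → D x → T (Interval v x y)
    below-maximal {x} {y} hi≡top ¬dy dx = subst T (tail≗ x y) (proj₂ lowest (suc y) suc-y-maximal (suc x) dx)
      where
      suc-y-maximal : Maximal Q (suc y)
      suc-y-maximal zero    = ¬dy
      suc-y-maximal (suc z) = Interval-maximal v y hi≡top z ∘ subst T (tail≗ y z)

  open Threshold v adm (λ y → T? (Q (suc y) zero)) down-closed no-N below-maximal

  extension : Σ ℕ λ a → AdmissibleStep v a × (∀ x y → Q x y ≡ Interval (v ∷ʳ a) x y)
  extension = a , a-step , Q≗
    where
    a = proj₁ threshold
    a-step = proj₂ (proj₂ threshold)
    D⇔ = proj₁ (proj₂ threshold)
    Q≗ : ∀ x y → Q x y ≡ Interval (v ∷ʳ a) x y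
    Q≗ zero    y       = trans (¬T⇒≡false (proj₁ lowest y))
                               (sym (¬T⇒≡false (Interval-maximal (v ∷ʳ a) zero refl y)))
    Q≗ (suc x) zero    = trans (T-ext (<⇒<ᵇ ∘ to (D⇔ x)) (from (D⇔ x) ∘ <ᵇ⇒< (hi v x) a))
                               (sym (cong₂ (λ u b → hi u x <ᵇ b) (init-∷ʳ a v) (last-∷ʳ a v)))
    Q≗ (suc x) (suc y) = trans (tail≗ x y) (sym (cong (λ u → Interval u x y) (init-∷ʳ a v)))

Representable : ∀ {n} → BRel n → Set
Representable {n} P = Σ (Vec ℕ n) λ v → Admissible v × Iso P (Interval v)

Representable-extend : ∀ {k} {P : BRel (suc (suc k))} → CPoset P → ∀ {m} → LowestMaximal P m →
                       (∀ (P′ : BRel (suc k)) → CPoset P′ → Representable P′) → Representable P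
Representable-extend {k} {P} cpP {m} m-lowest represent = extend (represent (λ x y → Q (suc x) (suc y)) cp-tail)
  where
  π : Permutation′ (suc (suc k))
  π = Perm.transpose zero m
  Q : BRel (suc (suc k))
  Q x y = P (π ⟨$⟩ʳ x) (π ⟨$⟩ʳ y)
  cpQ : CPoset Q
  cpQ = CPoset-pullback {P = Q} {Q = P} (π ⟨$⟩ʳ_) (permutation-injective π) (λ _ _ → refl) cpP
  cp-tail : CPoset (λ x y → Q (suc x) (suc y))
  cp-tail = CPoset-pullback {P = λ x y → Q (suc x) (suc y)} {Q = Q} suc fsuc-injective (λ _ _ → refl) cpQ
  lowestQ : LowestMaximal Q zero
  lowestQ = LowestMaximal-pullback {P = P} π {i = zero} m-lowest
  extend : Representable (λ x y → Q (suc x) (suc y)) → Representable P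
  extend (v , adm , iso) =
    v ∷ʳ a , Admissible-∷ʳ adm a-step ,
    Iso-sym {P = Interval (v ∷ʳ a)} {Q = P} (ρ ∘ₚ π , λ x y → sym (Q′≗ x y))
    where
    ρ : Permutation′ (suc (suc k))
    ρ = lift₀ (Perm.flip (proj₁ iso))
    Q′ : BRel (suc (suc k))
    Q′ x y = Q (ρ ⟨$⟩ʳ x) (ρ ⟨$⟩ʳ y)
    tail≗ : ∀ x y → Q′ (suc x) (suc y) ≡ Interval v x y
    tail≗ x y = sym (proj₂ (Iso-sym {P = λ x y → Q (suc x) (suc y)} {Q = Interval v} iso) x y)
    cpQ′ : CPoset Q′
    cpQ′ = CPoset-pullback {P = Q′} {Q = Q} (ρ ⟨$⟩ʳ_) (permutation-injective ρ) (λ _ _ → refl) cpQ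
    open Extension v adm {Q′} cpQ′ tail≗ (LowestMaximal-pullback {P = Q} ρ {i = zero} lowestQ)
    a = proj₁ extension
    a-step = proj₁ (proj₂ extension)
    Q′≗ = proj₂ (proj₂ extension)

Interval-surjective : ∀ {n} (P : BRel n) → CPoset P → Representable P
Interval-surjective {zero}        P _                        = [] , tt , Iso-≗ {Q = Interval []} λ ()
Interval-surjective {suc zero}    P ((irreflexive , _) , _) =
  0 ∷ [] , refl , Iso-≗ {Q = Interval (0 ∷ [])} λ { zero zero → irreflexive zero }
Interval-surjective {suc (suc k)} P cpP =
  Representable-extend cpP (proj₂ (lowest-maximal P (proj₁ cpP) (proj₁ (proj₂ cpP)))) Interval-surjective

proposition5p4 : ∀ (n : ℕ) →
    ((v : Vec ℕ n) → CAsc v → CPoset (fAP v)) ×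
    ((u v : Vec ℕ n) → CAsc u → CAsc v → Iso (fAP u) (fAP v) → u ≡ v) ×
    ((P : BRel n) → CPoset P → Σ (Vec ℕ n) λ v → CAsc v × Iso P (fAP v))
proposition5p4 n = CAsc⇒CPoset , injective , surjective
  where
  injective : (u v : Vec ℕ n) → CAsc u → CAsc v → Iso (fAP u) (fAP v) → u ≡ v
  injective u v cu cv iso = Interval-injective u v adm-u adm-v
    (Iso-resp-≗ (fAP≗Interval u adm-u) (fAP≗Interval v adm-v) iso)
    where
    adm-u = CAsc⇒Admissible u cu
    adm-v = CAsc⇒Admissible v cv
  surjective : (P : BRel n) → CPoset P → Σ (Vec ℕ n) λ v → CAsc v × Iso P (fAP v)
  surjective P cp = let v , adm , iso = Interval-surjective P cp in
    v , Admissible⇒CAsc v adm , Iso-resp-≗ (λ _ _ → refl) (sym ∘₂ fAP≗Interval v adm) iso
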